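{- There exist infinitely many graphs $G$ such that $\operatorname{fd}(G) - \operatorname{fd}(G+e) \ge |V(G)|/2 - 1$ for some edge $e$ of the complement $\overline{G}$ (i.e., some pair of nonadjacent vertices of $G$), where $G+e$ is the graph obtained from $G$ by adding $e$.
   Context: All graphs are finite and simple; $N(v)$ denotes the open neighborhood of $v$. For a graph $G=(V,E)$ and an integer $k \ge 1$, a $k$-fair dominating set is a dominating set $D \subseteq V$ such that $|N(v) \cap D| = k$ for every $v \in V \setminus D$ (the set $D = V$ qualifies vacuously). A fair dominating set (FD-set) is a set that is a $k$-fair dominating set for some $k \ge 1$. If $G$ has at least one edge, $\operatorname{fd}(G)$ is the minimum cardinality of an FD-set of $G$; by convention, $\operatorname{fd}(\overline{K_n}) = n$ for the edgeless graph on $n$ vertices. -}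

module Defs where

open import Data.Nat using (ℕ; _≤_; _+_; _*_)
open import Data.Bool using (Bool; true; false; _∧_; _∨_)
open import Data.Fin using (Fin; _≟_)
open import Data.Fin.Subset using (Subset; _∈_; _∉_; _∩_; ∣_∣; ⊤)
open import Data.Vec using (tabulate)
open import Data.Product using (Σ; ∃; ∃-syntax; _×_; _,_)
open import Data.Sum using (_⊎_)
open import Relation.Nullary using (¬_)
open import Relation.Nullary.Decidable using (⌊_⌋)
open import Relation.Binary.PropositionalEquality using (_≡_)

Adj : ℕ → Set
Adj n = Fin n → Fin n → Bool

record Graph (n : ℕ) : Set where
  field
    adj     : Adj n
    sym     : ∀ i j → adj i j ≡ adj j i
    irrefl  : ∀ i → adj i i ≡ false
open Graph public

N : ∀ {n} → Adj n → Fin n → Subset n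
N a v = tabulate (a v)

HasEdge : ∀ {n} → Adj n → Set
HasEdge a = ∃[ u ] ∃[ v ] a u v ≡ true

Dominating : ∀ {n} → Adj n → Subset n → Set
Dominating a D = ∀ v → v ∉ D → ∃[ u ] (u ∈ D × a v u ≡ true)

IsKFD : ∀ {n} → Adj n → ℕ → Subset n → Set
IsKFD a k D = Dominating a D × (∀ v → v ∉ D → ∣ N a v ∩ D ∣ ≡ k)

IsFD : ∀ {n} → Adj n → Subset n → Set
IsFD a D = ∃[ k ] (1 ≤ k × IsKFD a k D)

-- m = fd(G): minimum cardinality of an FD-set if G has an edge,
-- and n by convention for the edgeless graph.
IsFdNumber : ∀ {n} → Adj n → ℕ → Set
IsFdNumber {n} a m =
  (HasEdge a × (∃[ D ] (IsFD a D × ∣ D ∣ ≡ m)) × (∀ D → IsFD a D → m ≤ ∣ D ∣))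
  ⊎ (¬ HasEdge a × m ≡ n)

addEdge : ∀ {n} → Adj n → Fin n → Fin n → Adj n
addEdge a u v i j = a i j ∨ ((⌊ i ≟ u ⌋ ∧ ⌊ j ≟ v ⌋) ∨ (⌊ i ≟ v ⌋ ∧ ⌊ j ≟ u ⌋))

-- Take vertices w, x, y and m disjoint edges zᵢtᵢ, with w adjacent to everything
-- except x, x adjacent only to y, and y adjacent to w, x and every zᵢ.  Adding the
-- edge wx makes w universal, so fd(G + wx) = 1.  In G the set {w, x, t₁, …, tₘ}
-- is 2-fair, and no fair dominating set is smaller: a fair set must meet every
-- edge zᵢtᵢ (an uncovered pair forces k = 1, w ∈ D, y ∉ D, hence x ∈ D, and then y
-- sees two vertices of D), which already costs m vertices, and the fairness
-- equations at w, x and y force two further vertices.  So fd(G) = m + 2 while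
-- |V(G)| = 2m + 3.
module Submission where

open import Defs hiding (sym)
open import Data.Nat using (ℕ; _≤_; _+_; _*_)
open import Data.Bool using (false)
open import Data.Fin using (Fin)
open import Data.Product using (Σ; ∃; ∃-syntax; _×_)
open import Relation.Binary.PropositionalEquality using (_≡_; _≢_)

open import Data.Nat using (zero; suc; z≤n; s≤s)
open import Data.Nat.Properties
  using (≤-refl; ≤-trans; ≤-reflexive; n≤1+n; m≤m+n; m≤n+m; +-suc; +-identityʳ; <-irrefl; suc-injective; module ≤-Reasoning)
open import Data.Nat.Tactic.RingSolver using (solve-∀)
open import Data.Bool using (Bool; true; _∧_; _∨_)
open import Data.Bool.Properties using (∧-zeroʳ)
open import Data.Fin using (zero; suc)
open import Data.Fin.Subset using (Subset; _∈_; _∉_; _∩_; ∣_∣; ⁅_⁆)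
open import Data.Fin.Subset.Properties
  using (_∈?_; ∣⊥∣≡0; ∣⁅x⁆∣≡1; x∈⁅x⁆; x∉⁅y⁆⇒x≢y; ∩-identityˡ; ∩-zeroˡ; ∩-zeroʳ; x∈p⇒∣p-x∣<∣p∣; ∣p∣≤∣x∷p∣)
open import Data.Vec using ([]; _∷_; here; there; tabulate; replicate; lookup)
open import Data.Vec.Properties using (lookup⇒[]=; []=⇒lookup; lookup∘tabulate)
open import Data.Product using (_,_)
open import Data.Sum using (inj₁)
open import Data.Unit using (⊤; tt)
open import Data.Empty using (⊥; ⊥-elim)
open import Function using (_∘_; case_of_)
open import Relation.Nullary using (¬_; yes; no)
open import Relation.Binary.PropositionalEquality using (refl; sym; trans; cong; cong₂)

toℕ : Bool → ℕ
toℕ true  = 1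
toℕ false = 0

toℕ≤1 : ∀ b → toℕ b ≤ 1
toℕ≤1 true  = ≤-refl
toℕ≤1 false = z≤n

∣b∷p∣≡toℕb+∣p∣ : ∀ {n} b (p : Subset n) → ∣ b ∷ p ∣ ≡ toℕ b + ∣ p ∣
∣b∷p∣≡toℕb+∣p∣ true  p = refl
∣b∷p∣≡toℕb+∣p∣ false p = refl

tabulate-const : ∀ n (b : Bool) → tabulate {n = n} (λ _ → b) ≡ replicate n b
tabulate-const zero    b = refl
tabulate-const (suc n) b = cong (b ∷_) (tabulate-const n b)

∣full∩p∣≡∣p∣ : ∀ {n} (p : Subset n) → ∣ tabulate (λ _ → true) ∩ p ∣ ≡ ∣ p ∣
∣full∩p∣≡∣p∣ {n} p = trans (cong (λ q → ∣ q ∩ p ∣) (tabulate-const n true)) (cong ∣_∣ (∩-identityˡ p))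

∣empty∩p∣≡0 : ∀ {n} (p : Subset n) → ∣ tabulate (λ _ → false) ∩ p ∣ ≡ 0
∣empty∩p∣≡0 {n} p =
  trans (cong (λ q → ∣ q ∩ p ∣) (tabulate-const n false)) (trans (cong ∣_∣ (∩-zeroˡ p)) (∣⊥∣≡0 n))

∣b∷empty∩p∣≡toℕb : ∀ {n} b (p : Subset n) → ∣ b ∷ (tabulate (λ _ → false) ∩ p) ∣ ≡ toℕ b
∣b∷empty∩p∣≡toℕb b p =
  trans (∣b∷p∣≡toℕb+∣p∣ b (tabulate (λ _ → false) ∩ p))
        (trans (cong (toℕ b +_) (∣empty∩p∣≡0 p)) (+-identityʳ (toℕ b)))

∣p∩⁅i⁆∣≡1 : ∀ {n} (p : Subset n) {i} → i ∈ p → ∣ p ∩ ⁅ i ⁆ ∣ ≡ 1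
∣p∩⁅i⁆∣≡1 {suc n} (true ∷ p) here      = cong suc (trans (cong ∣_∣ (∩-zeroʳ p)) (∣⊥∣≡0 n))
∣p∩⁅i⁆∣≡1 (true ∷ p)  (there i∈p) = ∣p∩⁅i⁆∣≡1 p i∈p
∣p∩⁅i⁆∣≡1 (false ∷ p) (there i∈p) = ∣p∩⁅i⁆∣≡1 p i∈p

lookup≡false⇒∉ : ∀ {n} (p : Subset n) i → lookup p i ≡ false → i ∉ p
lookup≡false⇒∉ p i eq i∈p with () ← trans (sym ([]=⇒lookup i∈p)) eq

∈⇒1≤∣p∣ : ∀ {n} {p : Subset n} {i} → i ∈ p → 1 ≤ ∣ p ∣
∈⇒1≤∣p∣ i∈p = ≤-trans (s≤s z≤n) (x∈p⇒∣p-x∣<∣p∣ i∈p)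

∈N : ∀ {n} (a : Adj n) {v u} → a v u ≡ true → u ∈ N a v
∈N a {v} {u} e = lookup⇒[]= u (N a v) (trans (lookup∘tabulate (a v) u) e)

Fair : ∀ {n} → Adj n → ℕ → Subset n → Set
Fair a k D = ∀ v → v ∉ D → ∣ N a v ∩ D ∣ ≡ k

FD-set-nonempty : ∀ {n} (a : Adj (suc n)) D → IsFD a D → 1 ≤ ∣ D ∣
FD-set-nonempty a D (_ , _ , dominating , _) with zero ∈? D
... | yes 0∈D = ∈⇒1≤∣p∣ 0∈D
... | no  0∉D with _ , u∈D , _ ← dominating zero 0∉D = ∈⇒1≤∣p∣ u∈D

universal⇒fd≡1 : ∀ {n} (a : Adj (suc n)) u → HasEdge a → (∀ v → v ≢ u → a v u ≡ true) → IsFdNumber a 1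
universal⇒fd≡1 a u edge universal =
  inj₁ (edge , (⁅ u ⁆ , (1 , ≤-refl , dominating , fair) , ∣⁅x⁆∣≡1 u) , FD-set-nonempty a)
  where
  dominating : Dominating a ⁅ u ⁆
  dominating v v∉ = u , x∈⁅x⁆ u , universal v (x∉⁅y⁆⇒x≢y v∉)

  fair : Fair a 1 ⁅ u ⁆
  fair v v∉ = ∣p∩⁅i⁆∣≡1 (N a v) (∈N a (universal v (x∉⁅y⁆⇒x≢y v∉)))

pairs : ℕ → ℕ
pairs zero    = zero
pairs (suc m) = suc (suc (pairs m))

pairs≡m+m : ∀ m → pairs m ≡ m + m
pairs≡m+m zero    = refl
pairs≡m+m (suc m) = cong suc (trans (cong suc (pairs≡m+m m)) (sym (+-suc m m)))

isZ : ∀ m → Fin (pairs m) → Bool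
isZ (suc m) zero          = true
isZ (suc m) (suc zero)    = false
isZ (suc m) (suc (suc i)) = isZ m i

zs ts : ∀ m → Subset (pairs m)
zs m = tabulate (isZ m)
ts zero    = []
ts (suc m) = false ∷ true ∷ ts m

matching : ∀ m → Adj (pairs m)
matching (suc m) zero          zero          = false
matching (suc m) zero          (suc zero)    = true
matching (suc m) zero          (suc (suc j)) = false
matching (suc m) (suc zero)    zero          = true
matching (suc m) (suc zero)    (suc zero)    = false
matching (suc m) (suc zero)    (suc (suc j)) = false
matching (suc m) (suc (suc i)) zero          = false
matching (suc m) (suc (suc i)) (suc zero)    = false
matching (suc m) (suc (suc i)) (suc (suc j)) = matching m i j

matching-sym : ∀ m i j → matching m i j ≡ matching m j i
matching-sym (suc m) zero          zero          = refl
matching-sym (suc m) zero          (suc zero)    = refl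
matching-sym (suc m) zero          (suc (suc j)) = refl
matching-sym (suc m) (suc zero)    zero          = refl
matching-sym (suc m) (suc zero)    (suc zero)    = refl
matching-sym (suc m) (suc zero)    (suc (suc j)) = refl
matching-sym (suc m) (suc (suc i)) zero          = refl
matching-sym (suc m) (suc (suc i)) (suc zero)    = refl
matching-sym (suc m) (suc (suc i)) (suc (suc j)) = matching-sym m i j

matching-irrefl : ∀ m i → matching m i i ≡ false
matching-irrefl (suc m) zero          = refl
matching-irrefl (suc m) (suc zero)    = refl
matching-irrefl (suc m) (suc (suc i)) = matching-irrefl m i

∣ts∣≡m : ∀ m → ∣ ts m ∣ ≡ m
∣ts∣≡m zero    = refl
∣ts∣≡m (suc m) = cong suc (∣ts∣≡m m)

∣zs∩ts∣≡0 : ∀ m → ∣ zs m ∩ ts m ∣ ≡ 0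
∣zs∩ts∣≡0 zero    = refl
∣zs∩ts∣≡0 (suc m) = ∣zs∩ts∣≡0 m

∉ts⇒∣N∩ts∣≡1 : ∀ m i → i ∉ ts m → ∣ N (matching m) i ∩ ts m ∣ ≡ 1
∉ts⇒∣N∩ts∣≡1 (suc m) zero          _   = cong suc (∣empty∩p∣≡0 (ts m))
∉ts⇒∣N∩ts∣≡1 (suc m) (suc zero)    i∉ = ⊥-elim (i∉ (there here))
∉ts⇒∣N∩ts∣≡1 (suc m) (suc (suc i)) i∉ = ∉ts⇒∣N∩ts∣≡1 m i (i∉ ∘ there ∘ there)

AllPairs : (Bool → Bool → Set) → ∀ m → Subset (pairs m) → Set
AllPairs P zero    []            = ⊤
AllPairs P (suc m) (dz ∷ dt ∷ R) = P dz dt × AllPairs P m R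

AllPairs-map : ∀ {P Q : Bool → Bool → Set} → (∀ {dz dt} → P dz dt → Q dz dt) →
               ∀ m {R} → AllPairs P m R → AllPairs Q m R
AllPairs-map f zero    {[]}          tt         = tt
AllPairs-map f (suc m) {dz ∷ dt ∷ R} (pr , prs) = f pr , AllPairs-map f m prs

meets-pairs⇒m≤∣R∣ : ∀ m {R} → AllPairs (λ dz dt → dz ∨ dt ≡ true) m R → m ≤ ∣ R ∣
meets-pairs⇒m≤∣R∣ zero    {[]}               tt          = z≤n
meets-pairs⇒m≤∣R∣ (suc m) {true  ∷ dt ∷ R}   (_ , covers) = s≤s (≤-trans (meets-pairs⇒m≤∣R∣ m covers) (∣p∣≤∣x∷p∣ dt R))
meets-pairs⇒m≤∣R∣ (suc m) {false ∷ true ∷ R} (_ , covers) = s≤s (meets-pairs⇒m≤∣R∣ m covers)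

zs⊆R⇒∣zs∩R∣≡m : ∀ m {R} → AllPairs (λ dz _ → dz ≡ true) m R → ∣ zs m ∩ R ∣ ≡ m
zs⊆R⇒∣zs∩R∣≡m zero    {[]}             tt          = refl
zs⊆R⇒∣zs∩R∣≡m (suc m) {true ∷ dt ∷ R} (refl , zs∈) = cong suc (zs⊆R⇒∣zs∩R∣≡m m zs∈)

-- Vertices are w, x, y followed by the pairs z₀, t₀, z₁, t₁, … of the matching.
pattern w    = zero
pattern x    = suc zero
pattern y    = suc (suc zero)
pattern pv i = suc (suc (suc i))

edge : ∀ m → Adj (3 + pairs m)
edge m w      w      = false
edge m w      x      = false
edge m w      y      = true
edge m w      (pv j) = true
edge m x      w      = false
edge m x      x      = false
edge m x      y      = true
edge m x      (pv j) = false
edge m y      w      = true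
edge m y      x      = true
edge m y      y      = false
edge m y      (pv j) = isZ m j
edge m (pv i) w      = true
edge m (pv i) x      = false
edge m (pv i) y      = isZ m i
edge m (pv i) (pv j) = matching m i j

edge-sym : ∀ m u v → edge m u v ≡ edge m v u
edge-sym m w      w      = refl
edge-sym m w      x      = refl
edge-sym m w      y      = refl
edge-sym m w      (pv j) = refl
edge-sym m x      w      = refl
edge-sym m x      x      = refl
edge-sym m x      y      = refl
edge-sym m x      (pv j) = refl
edge-sym m y      w      = refl
edge-sym m y      x      = refl
edge-sym m y      y      = refl
edge-sym m y      (pv j) = refl
edge-sym m (pv i) w      = refl
edge-sym m (pv i) x      = refl
edge-sym m (pv i) y      = refl
edge-sym m (pv i) (pv j) = matching-sym m i j

edge-irrefl : ∀ m v → edge m v v ≡ false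
edge-irrefl m w      = refl
edge-irrefl m x      = refl
edge-irrefl m y      = refl
edge-irrefl m (pv i) = matching-irrefl m i

G : ∀ m → Graph (3 + pairs m)
G m = record { adj = edge m ; sym = edge-sym m ; irrefl = edge-irrefl m }

module _ (m : ℕ) (dw dx dy : Bool) (R : Subset (pairs m)) where

  private
    D : Subset (3 + pairs m)
    D = dw ∷ dx ∷ dy ∷ R

  ∣N[w]∩D∣ : ∣ N (edge m) w ∩ D ∣ ≡ toℕ dy + ∣ R ∣
  ∣N[w]∩D∣ = trans (∣b∷p∣≡toℕb+∣p∣ dy (tabulate (λ _ → true) ∩ R)) (cong (toℕ dy +_) (∣full∩p∣≡∣p∣ R))

  ∣N[x]∩D∣ : ∣ N (edge m) x ∩ D ∣ ≡ toℕ dy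
  ∣N[x]∩D∣ = ∣b∷empty∩p∣≡toℕb dy R

  ∣N[y]∩D∣ : ∣ N (edge m) y ∩ D ∣ ≡ toℕ dw + (toℕ dx + ∣ zs m ∩ R ∣)
  ∣N[y]∩D∣ = trans (∣b∷p∣≡toℕb+∣p∣ dw (dx ∷ false ∷ (zs m ∩ R)))
                   (cong (toℕ dw +_) (∣b∷p∣≡toℕb+∣p∣ dx (false ∷ (zs m ∩ R))))

  ∣N[pv]∩D∣ : ∀ i → ∣ N (edge m) (pv i) ∩ D ∣ ≡ toℕ dw + (toℕ (isZ m i ∧ dy) + ∣ N (matching m) i ∩ R ∣)
  ∣N[pv]∩D∣ i = trans (∣b∷p∣≡toℕb+∣p∣ dw (false ∷ (isZ m i ∧ dy) ∷ (N (matching m) i ∩ R)))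
                      (cong (toℕ dw +_) (∣b∷p∣≡toℕb+∣p∣ (isZ m i ∧ dy) (N (matching m) i ∩ R)))

-- The fairness equations at zᵢ and at tᵢ; dz and dt record whether zᵢ, tᵢ ∈ D.
PairFair : Bool → Bool → ℕ → Bool → Bool → Set
PairFair dw dy k dz dt = (dz ≡ false → toℕ dw + (toℕ dy + toℕ dt) ≡ k) × (dt ≡ false → toℕ dw + toℕ dz ≡ k)

record FairnessEquations (m k : ℕ) (dw dx dy : Bool) (R : Subset (pairs m)) : Set where
  field
    at-w     : dw ≡ false → toℕ dy + ∣ R ∣ ≡ k
    at-x     : dx ≡ false → toℕ dy ≡ k
    at-y     : dy ≡ false → toℕ dw + (toℕ dx + ∣ zs m ∩ R ∣) ≡ k
    at-pairs : AllPairs (PairFair dw dy k) m R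
open FairnessEquations

pairs-fair : ∀ m {dw dy k} (R : Subset (pairs m)) →
             (∀ i → lookup R i ≡ false → toℕ dw + (toℕ (isZ m i ∧ dy) + ∣ N (matching m) i ∩ R ∣) ≡ k) →
             AllPairs (PairFair dw dy k) m R
pairs-fair zero    []                      fair = tt
pairs-fair (suc m) {dw} {dy} (dz ∷ dt ∷ R) fair =
  ( (λ dz≡false → trans (cong (λ c → toℕ dw + (toℕ dy + c)) (sym (∣b∷empty∩p∣≡toℕb dt R))) (fair zero dz≡false))
  , (λ dt≡false → trans (cong (toℕ dw +_) (sym (∣b∷empty∩p∣≡toℕb dz (dt ∷ R)))) (fair (suc zero) dt≡false)) )
  , pairs-fair m R (λ i → fair (suc (suc i)))

fair⇒equations : ∀ m {k} dw dx dy (R : Subset (pairs m)) →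
                 Fair (edge m) k (dw ∷ dx ∷ dy ∷ R) → FairnessEquations m k dw dx dy R
fair⇒equations m {k} dw dx dy R fair = record
  { at-w     = λ e → trans (sym (∣N[w]∩D∣ m dw dx dy R)) (fair-at w e)
  ; at-x     = λ e → trans (sym (∣N[x]∩D∣ m dw dx dy R)) (fair-at x e)
  ; at-y     = λ e → trans (sym (∣N[y]∩D∣ m dw dx dy R)) (fair-at y e)
  ; at-pairs = pairs-fair m R (λ i e → trans (sym (∣N[pv]∩D∣ m dw dx dy R i)) (fair-at (pv i) e))
  }
  where
  fair-at : ∀ v → lookup (dw ∷ dx ∷ dy ∷ R) v ≡ false → ∣ N (edge m) v ∩ (dw ∷ dx ∷ dy ∷ R) ∣ ≡ k
  fair-at v e = fair v (lookup≡false⇒∉ (dw ∷ dx ∷ dy ∷ R) v e)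

uncovered-pair-impossible : ∀ {m k} dw dx dy {R} → 1 ≤ k → FairnessEquations m k dw dx dy R →
                            ¬ PairFair dw dy k false false
uncovered-pair-impossible dw dx dy 1≤k eqs (at-z , at-t) = impossible dw dx dy 1≤k eqs (at-z refl) (at-t refl)
  where
  -- The equation at tᵢ fixes k = [w ∈ D], forcing w ∈ D and k = 1; the one at zᵢ then
  -- excludes y, and the equation at x or at y fails.
  impossible : ∀ {m k} dw dx dy {R} → 1 ≤ k → FairnessEquations m k dw dx dy R →
               toℕ dw + (toℕ dy + 0) ≡ k → toℕ dw + 0 ≡ k → ⊥
  impossible false _     _     ()  _   _  refl
  impossible true  _     true  _   _   () refl
  impossible true  false false _   eqs _  refl = case at-x eqs refl of λ ()
  impossible true  true  false _   eqs _  refl = case at-y eqs refl of λ ()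

equations⇒m≤∣R∣ : ∀ {m k} dw dx dy {R} → 1 ≤ k → FairnessEquations m k dw dx dy R → m ≤ ∣ R ∣
equations⇒m≤∣R∣ {m} dw dx dy 1≤k eqs = meets-pairs⇒m≤∣R∣ m (AllPairs-map covered m (at-pairs eqs))
  where
  covered : ∀ {dz dt} → PairFair dw dy _ dz dt → dz ∨ dt ≡ true
  covered {true}          _  = refl
  covered {false} {true}  _  = refl
  covered {false} {false} pf = ⊥-elim (uncovered-pair-impossible dw dx dy 1≤k eqs pf)

equations⇒2+m≤∣D∣ : ∀ {m k} dw dx dy {R} → 2 ≤ m → 1 ≤ k → FairnessEquations m k dw dx dy R →
                   2 + m ≤ ∣ dw ∷ dx ∷ dy ∷ R ∣
equations⇒2+m≤∣D∣ dw false false 2≤m 1≤k eqs with refl ← at-x eqs refl = case 1≤k of λ ()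
equations⇒2+m≤∣D∣ false false true {R} 2≤m 1≤k eqs =
  case ≤-trans 2≤m (≤-trans (equations⇒m≤∣R∣ false false true 1≤k eqs) (≤-reflexive ∣R∣≡0)) of λ ()
  where
  ∣R∣≡0 : ∣ R ∣ ≡ 0
  ∣R∣≡0 = suc-injective (trans (at-w eqs refl) (sym (at-x eqs refl)))
equations⇒2+m≤∣D∣ true false true  2≤m 1≤k eqs = s≤s (s≤s (equations⇒m≤∣R∣ true false true 1≤k eqs))
equations⇒2+m≤∣D∣ true true  true  2≤m 1≤k eqs =
  s≤s (s≤s (≤-trans (equations⇒m≤∣R∣ true true true 1≤k eqs) (n≤1+n _)))
equations⇒2+m≤∣D∣ false true true  2≤m 1≤k eqs = s≤s (s≤s (equations⇒m≤∣R∣ false true true 1≤k eqs))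
equations⇒2+m≤∣D∣ true true  false 2≤m 1≤k eqs = s≤s (s≤s (equations⇒m≤∣R∣ true true false 1≤k eqs))
equations⇒2+m≤∣D∣ {m} {k} false true false {R} 2≤m 1≤k eqs = s≤s (≤-reflexive (sym ∣R∣≡1+m))
  where
  -- With w, y ∉ D the fairness constant is k = |R| ≥ m ≥ 2, more than a z outside D could see.
  2≤k : 2 ≤ k
  2≤k = ≤-trans 2≤m (≤-trans (equations⇒m≤∣R∣ false true false 1≤k eqs) (≤-reflexive (at-w eqs refl)))

  z∈D : ∀ {dz dt} → PairFair false false k dz dt → dz ≡ true
  z∈D {true}       _          = refl
  z∈D {false} {dt} (at-z , _) =
    ⊥-elim (<-irrefl refl (≤-trans 2≤k (≤-trans (≤-reflexive (sym (at-z refl))) (toℕ≤1 dt))))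

  ∣R∣≡1+m : ∣ R ∣ ≡ suc m
  ∣R∣≡1+m = trans (at-w eqs refl)
                  (trans (sym (at-y eqs refl)) (cong suc (zs⊆R⇒∣zs∩R∣≡m m (AllPairs-map z∈D m (at-pairs eqs)))))

fd-lower-bound : ∀ m → 2 ≤ m → ∀ D → IsFD (edge m) D → 2 + m ≤ ∣ D ∣
fd-lower-bound m 2≤m (dw ∷ dx ∷ dy ∷ R) (k , 1≤k , _ , fair) =
  equations⇒2+m≤∣D∣ dw dx dy 2≤m 1≤k (fair⇒equations m dw dx dy R fair)

fd[G]≡2+m : ∀ m → 2 ≤ m → IsFdNumber (edge m) (2 + m)
fd[G]≡2+m m 2≤m =
  inj₁ ((w , y , refl) , (D₀ , (2 , s≤s z≤n , dominating , fair) , cong (2 +_) (∣ts∣≡m m)) , fd-lower-bound m 2≤m)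
  where
  D₀ : Subset (3 + pairs m)
  D₀ = true ∷ true ∷ false ∷ ts m

  dominating : Dominating (edge m) D₀
  dominating w      v∉ = ⊥-elim (v∉ here)
  dominating x      v∉ = ⊥-elim (v∉ (there here))
  dominating y      v∉ = w , here , refl
  dominating (pv i) v∉ = w , here , refl

  fair : Fair (edge m) 2 D₀
  fair w      v∉ = ⊥-elim (v∉ here)
  fair x      v∉ = ⊥-elim (v∉ (there here))
  fair y      v∉ = trans (∣N[y]∩D∣ m true true false (ts m)) (cong (2 +_) (∣zs∩ts∣≡0 m))
  fair (pv i) v∉ =
    trans (∣N[pv]∩D∣ m true true false (ts m) i)
          (cong suc (cong₂ _+_ (cong toℕ (∧-zeroʳ (isZ m i))) (∉ts⇒∣N∩ts∣≡1 m i (v∉ ∘ there ∘ there ∘ there))))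

fd[G+wx]≡1 : ∀ m → IsFdNumber (addEdge (edge m) w x) 1
fd[G+wx]≡1 m = universal⇒fd≡1 (addEdge (edge m) w x) w hasEdge universal
  where
  hasEdge : HasEdge (addEdge (edge m) w x)
  hasEdge = w , y , refl

  universal : ∀ v → v ≢ w → addEdge (edge m) w x v w ≡ true
  universal w      w≢w = ⊥-elim (w≢w refl)
  universal x      _   = refl
  universal y      _   = refl
  universal (pv i) _   = refl

proposition6 : ∀ (M : ℕ) → ∃[ n ] (M ≤ n × Σ (Graph n) λ G → ∃[ u ] ∃[ v ] (u ≢ v × adj G u v ≡ false × ∃[ a ] ∃[ b ] (IsFdNumber (adj G) a × IsFdNumber (addEdge (adj G) u v) b × 2 * b + n ≤ 2 * a + 2)))
proposition6 M =
  3 + pairs m , M≤n , G m , w , x , (λ ()) , refl , 2 + m , 1 , fd[G]≡2+m m (m≤m+n 2 M) , fd[G+wx]≡1 m , gap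
  where
  m : ℕ
  m = 2 + M

  M≤n : M ≤ 3 + pairs m
  M≤n = begin
    M                ≤⟨ m≤n+m M 5 ⟩
    5 + M            ≤⟨ m≤m+n (5 + M) (2 + M) ⟩
    5 + M + (2 + M)  ≡⟨ cong (3 +_) (sym (pairs≡m+m m)) ⟩
    3 + pairs m      ∎
    where open ≤-Reasoning

  gap : 2 * 1 + (3 + pairs m) ≤ 2 * (2 + m) + 2
  gap = begin
    2 + (3 + pairs m)        ≡⟨ cong (5 +_) (pairs≡m+m m) ⟩
    5 + (m + m)              ≤⟨ n≤1+n _ ⟩
    6 + (m + m)              ≡⟨ 6+n+n≡2[2+n]+2 m ⟩
    2 * (2 + m) + 2          ∎
    where
    open ≤-Reasoning
    6+n+n≡2[2+n]+2 : ∀ n → 6 + (n + n) ≡ 2 * (2 + n) + 2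
    6+n+n≡2[2+n]+2 = solve-∀
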